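{- For every $n\ge1$, the map $F\mapsto c(F)$ is a bijection from the set of pointed Lyndon forests with leaf label set $[n]$ to the set of saturated chains of $\Pi_n^\bullet$ starting at $\hat0$ that are ascent-free with respect to $\lambda_\bullet$.
   Context: Pointed partitions: a pointed set is $A^p$ with $A$ nonempty finite, $p\in A$; a pointed partition of $[n]$ is a collection of pointed sets whose underlying sets partition $[n]$. In $\Pi_n^\bullet$, $\pi\lessdot\pi'$ when $\pi'$ arises by replacing two blocks $A^p,B^q$ ($\min A<\min B$) by $(A\cup B)^p$ (1-merge) or $(A\cup B)^q$ (0-merge); $\hat0$ is the partition into singletons. $\lambda_\bullet$ labels a $u$-merge by $(\min A,\min B)^u\in\Lambda_n^\bullet$, where $\Lambda_n^\bullet$ has elements $(a,b)^u$ ($1\le a<b\le n$, $u\in\{0,1\}$), ordered as the ordinal sum $A_1\oplus C_1\oplus\cdots\oplus A_{n-1}\oplus C_{n-1}$, $A_a$ the antichain $\{(a,b)^0\}$ and $C_a$ the chain $\{(a,b)^1\}$ with $(a,b)^1<(a,c)^1$ iff $b<c$. A saturated chain is ascent-free if no two consecutive labels $\ell_i,\ell_{i+1}$ satisfy $\ell_i<\ell_{i+1}$. Trees: a bicolored binary forest on $[n]$ is a forest of rooted planar binary trees (every internal vertex has a left child $L(v)$ and a right child $R(v)$), whose leaves are bijectively labeled by $[n]$, each internal vertex $v$ having a color $\mathrm{color}(v)\in\{0,1\}$. The valency $\nu(v)$ is the smallest leaf label in the subtree rooted at $v$. The forest is normalized if $\nu(v)=\nu(L(v))$ for every internal $v$.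 An internal vertex $v$ is Lyndon if $L(v)$ is a leaf or $\nu(R(L(v)))>\nu(R(v))$. A normalized bicolored binary tree is a pointed Lyndon tree if every internal vertex $v$ whose left child is internal satisfies $\mathrm{color}(L(v))\ge\mathrm{color}(v)$, and, if $\mathrm{color}(L(v))=\mathrm{color}(v)=1$, $v$ is Lyndon. A pointed Lyndon forest is a forest all of whose components are pointed Lyndon trees. The reverse-minimal linear extension of a normalized forest is the unique ordering $v_1,\dots,v_k$ of its internal vertices in which each vertex precedes its parent and $\nu(v_1)\ge\cdots\ge\nu(v_k)$. For such a forest $F$, $c(F)$ is the chain in $\Pi_n^\bullet$ starting at $\hat0$ whose $i$-th step merges the two blocks consisting of the leaf labels of the left and right subtrees of $v_i$, keeping the pointed element of the left block if $\mathrm{color}(v_i)=1$ and of the right block if $\mathrm{color}(v_i)=0$; equivalently its label sequence is $(\nu(L(v_1)),\nu(R(v_1)))^{\mathrm{color}(v_1)}\cdots(\nu(L(v_k)),\nu(R(v_k)))^{\mathrm{color}(v_k)}$. -}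

module Defs where

open import Data.Nat as ℕ using (ℕ; _≤ᵇ_)
open import Data.Bool using (Bool; true; false; if_then_else_; _∨_) renaming (_≤_ to _≤𝔹_)
open import Data.Fin using (Fin; toℕ; _<_; _≟_)
open import Data.List using (List; []; _∷_; [_]; _++_; concatMap; filter; reverse; allFin)
open import Data.List.Relation.Unary.All using (All)
open import Data.List.Relation.Unary.Linked using (Linked)
open import Data.List.Relation.Binary.Permutation.Propositional using (_↭_)
open import Data.Vec as Vec using (Vec; lookup)
open import Data.Product using (Σ; _×_; ∃)
open import Data.Sum using (_⊎_)
open import Data.Unit using (⊤)
open import Relation.Nullary using (¬_; does)
open import Relation.Binary.PropositionalEquality using (_≡_)

-- The ground set [n] = {1,…,n} is represented by Fin n (element i+1 ↔ i),
-- which preserves the order.  A pointed partition is encoded by the vector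
-- π : Vec (Fin n) n sending each element to the pointed element of its
-- block; such a vector is exactly an idempotent map (blocks = fibres,
-- pointed elements = fixed points).

Part : ℕ → Set
Part n = Vec (Fin n) n

IsPointedPartition : ∀ {n} → Part n → Set
IsPointedPartition {n} π = ∀ (i : Fin n) → lookup π (lookup π i) ≡ lookup π i

zeroP : ∀ n → Part n
zeroP n = Vec.allFin n

merge : ∀ {n} → Part n → Fin n → Fin n → Part n
merge π p q = Vec.map (λ x → if does (x ≟ p) ∨ does (x ≟ q) then p else x) π

IsBlockMin : ∀ {n} → Part n → Fin n → Fin n → Set
IsBlockMin {n} π p m = (lookup π m ≡ p) × (∀ (j : Fin n) → lookup π j ≡ p → toℕ m ℕ.≤ toℕ j)

-- Labels Λ_n^• : (a,b)^u with a < b, u ∈ {0,1} (true = 1, false = 0)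

record Label (n : ℕ) : Set where
  constructor lab
  field
    a : Fin n
    b : Fin n
    u : Bool

-- the order of the ordinal sum A_1 ⊕ C_1 ⊕ ⋯ ⊕ A_{n-1} ⊕ C_{n-1}
data _<Λ_ {n : ℕ} : Label n → Label n → Set where
  diff-a : ∀ {a b u a' b' u'} → a < a' → lab a b u <Λ lab a' b' u'
  A<C    : ∀ {a b b'} → lab a b false <Λ lab a b' true
  inC    : ∀ {a b b'} → b < b' → lab a b true <Λ lab a b' true

-- π ⋖ π' in Π_n^• with λ_•(π,π') = ℓ :
-- blocks A^p, B^q of π with min A = a < min B = b are merged into
-- (A∪B)^p (1-merge, label (a,b)^1) or (A∪B)^q (0-merge, label (a,b)^0).
Step : ∀ {n} → Part n → Part n → Label n → Set
Step {n} π π' (lab a b u) =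
  IsPointedPartition π × (a < b) ×
  Σ (Fin n) λ p → Σ (Fin n) λ q →
    (lookup π p ≡ p) × (lookup π q ≡ q) ×
    IsBlockMin π p a × IsBlockMin π q b ×
    (π' ≡ (if u then merge π p q else merge π q p))

data ChainFrom {n : ℕ} : Part n → List (Part n) → List (Label n) → Set where
  done : ∀ {π} → ChainFrom π [] []
  step : ∀ {π π' rest ℓ ls} → Step π π' ℓ → ChainFrom π' rest ls →
         ChainFrom π (π' ∷ rest) (ℓ ∷ ls)

NoAscent : ∀ {n} → List (Label n) → Set
NoAscent [] = ⊤
NoAscent (x ∷ []) = ⊤
NoAscent (x ∷ y ∷ r) = ¬ (x <Λ y) × NoAscent (y ∷ r)

AscentFreeChain : ∀ n → List (Part n) → Set
AscentFreeChain n ch =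
  Σ (List (Part n)) λ rest → Σ (List (Label n)) λ ls →
    (ch ≡ zeroP n ∷ rest) × ChainFrom (zeroP n) rest ls × NoAscent ls

data Tree (n : ℕ) : Set where
  leaf : Fin n → Tree n
  node : Bool → Tree n → Tree n → Tree n

minF : ∀ {n} → Fin n → Fin n → Fin n
minF i j = if toℕ i ≤ᵇ toℕ j then i else j

ν : ∀ {n} → Tree n → Fin n
ν (leaf i) = i
ν (node c l r) = minF (ν l) (ν r)

leaves : ∀ {n} → Tree n → List (Fin n)
leaves (leaf i) = [ i ]
leaves (node c l r) = leaves l ++ leaves r

LeftCond : ∀ {n} → Bool → Tree n → Tree n → Set
LeftCond c (leaf _) r = ⊤
LeftCond c (node c' ll lr) r =
  (c ≤𝔹 c') × (c' ≡ true → c ≡ true → toℕ (ν r) ℕ.< toℕ (ν lr))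

PointedLyndonTree : ∀ {n} → Tree n → Set
PointedLyndonTree (leaf i) = ⊤
PointedLyndonTree (node c l r) =
  (ν (node c l r) ≡ ν l) × LeftCond c l r ×
  PointedLyndonTree l × PointedLyndonTree r

-- A forest is a set of trees; it is represented canonically by the list
-- of its trees in strictly increasing order of root valency.
Forest : ℕ → Set
Forest n = List (Tree n)

forestLeaves : ∀ {n} → Forest n → List (Fin n)
forestLeaves = concatMap leaves

PointedLyndonForest : ∀ n → Forest n → Set
PointedLyndonForest n F =
  All PointedLyndonTree F ×
  (forestLeaves F ↭ allFin n) ×
  Linked (λ s t → toℕ (ν s) ℕ.< toℕ (ν t)) F

postorder : ∀ {n} → Tree n → List (Tree n)
postorder (leaf i) = []
postorder (node c l r) = postorder l ++ postorder r ++ [ node c l r ]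

-- For m = n-1, …, 0 list the internal vertices of valency m, in post-order
-- (for fixed m these lie on one left spine, so post-order = bottom-up).
-- This is the ordering with nonincreasing valency in which each vertex
-- precedes its parent.
revMinLinExt : ∀ {n} → Forest n → List (Tree n)
revMinLinExt {n} F =
  concatMap (λ m → filter (λ v → ν v ≟ m) (concatMap postorder F))
            (reverse (allFin n))

mergeStep : ∀ {n} → Part n → Tree n → Part n
mergeStep π (leaf i) = π
mergeStep π (node true l r) = merge π (lookup π (ν l)) (lookup π (ν r))
mergeStep π (node false l r) = merge π (lookup π (ν r)) (lookup π (ν l))

runChain : ∀ {n} → Part n → List (Tree n) → List (Part n)
runChain π [] = [ π ]
runChain π (v ∷ vs) = π ∷ runChain (mergeStep π v) vs

c : ∀ n → Forest n → List (Part n)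
c n F = runChain (zeroP n) (revMinLinExt F)

-- A forest F covering [n] determines the pointed partition partOf F whose blocks are the leaf
-- sets of its trees, each pointed at the leaf reached by following the colours.  Replacing the
-- root of least valency by its two subtrees gives a forest F' with c(F) = c(F') followed by
-- partOf F, and this last step is a cover labelled by that root.  The label before it is that
-- of a root of F': for the left child an ascent is ruled out by the pointed Lyndon conditions,
-- for the other roots by their larger valency.  Conversely, each step of an ascent-free chain
-- joins the two trees whose valencies are the block minima; the absence of an ascent makes the
-- new tree pointed Lyndon and keeps its root of least valency, so the chain is c of the forest
-- built step by step.  A step determines the merged root, so c is injective up to the order of
-- the trees, which is fixed by sorting them by valency.

module Submission where

open import Defs
open import Data.Bool using (Bool; true; false; if_then_else_; T; _∨_)
open import Data.Bool.Base using (b≤b; f≤t) renaming (_≤_ to _≤𝔹_)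
open import Data.Empty using (⊥; ⊥-elim)
open import Data.Fin as Fin using (Fin; toℕ; _≟_)
import Data.Fin.Properties as FinP
open import Data.List using (List; []; _∷_; [_]; _++_; concat; concatMap; filter; reverse; allFin; map; length)
import Data.List.Properties as LP
open import Data.List.Membership.Propositional using (_∈_; _∉_; find; lose)
open import Data.List.Membership.Propositional.Properties
  using (∈-++⁺ˡ; ∈-++⁺ʳ; ∈-++⁻; ∈-allFin; ∈-concatMap⁺; ∈-concatMap⁻)
open import Data.List.Relation.Binary.Permutation.Propositional
  using (_↭_; refl; prep; swap; ↭-sym; ↭⇒↭ₛ) renaming (trans to ↭-trans)
import Data.List.Relation.Binary.Permutation.Propositional.Properties as PermP
import Data.List.Relation.Binary.Permutation.Setoid.Properties as PermS
open import Data.List.Relation.Unary.All as All using (All; []; _∷_)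
import Data.List.Relation.Unary.All.Properties as AllP
open import Data.List.Relation.Unary.AllPairs as AllPairs using (AllPairs; _∷_)
import Data.List.Relation.Unary.AllPairs.Properties as AllPairsP
open import Data.List.Relation.Unary.Any as Any using (here; there)
open import Data.List.Relation.Unary.Linked as Linked using (Linked)
open import Data.List.Relation.Unary.Linked.Properties using (AllPairs⇒Linked; Linked⇒AllPairs)
open import Data.List.Relation.Unary.Unique.Propositional using (Unique)
import Data.List.Relation.Unary.Unique.Propositional.Properties as UniqueP
import Data.List.Sort as Sort
open import Data.Nat as ℕ using (ℕ; zero; suc; _≤_; _≤ᵇ_)
import Data.Nat.Properties as ℕP
open import Data.Product using (Σ; _×_; _,_; proj₁; proj₂)
open import Data.Sum using (_⊎_; inj₁; inj₂) renaming (swap to ⊎-swap)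
open import Data.Unit using (⊤; tt)
open import Data.Vec using (lookup; tabulate)
import Data.Vec.Properties as VecP
import Data.Vec.Relation.Binary.Pointwise.Extensional as Pointwise
open import Function using (_∘_)
open import Relation.Binary using (tri<; tri≈; tri>)
import Relation.Binary.Construct.On as On
open import Relation.Binary.PropositionalEquality
  using (_≡_; _≢_; refl; sym; trans; cong; cong₂; subst; subst₂; setoid; module ≡-Reasoning)
open import Relation.Nullary using (¬_; Dec; yes; no; does)

concatMap-↭ : ∀ {A B : Set} (f : A → List B) {xs ys} → xs ↭ ys → concatMap f xs ↭ concatMap f ys
concatMap-↭ f refl         = refl
concatMap-↭ f (prep x p)   = PermP.++⁺ˡ (f x) (concatMap-↭ f p)
concatMap-↭ f (swap x y p) =
  ↭-trans (PermP.shifts (f x) (f y)) (PermP.++⁺ˡ (f y) (PermP.++⁺ˡ (f x) (concatMap-↭ f p)))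
concatMap-↭ f (↭-trans p q) = ↭-trans (concatMap-↭ f p) (concatMap-↭ f q)

Unique-resp-↭ : ∀ {A : Set} {xs ys : List A} → xs ↭ ys → Unique xs → Unique ys
Unique-resp-↭ {A} p = PermS.Unique-resp-↭ (setoid A) (↭⇒↭ₛ p)

Unique-++⁻ʳ : ∀ {A : Set} (xs : List A) {ys} → Unique (xs ++ ys) → Unique ys
Unique-++⁻ʳ []       u       = u
Unique-++⁻ʳ (x ∷ xs) (_ ∷ u) = Unique-++⁻ʳ xs u

Unique-++-disjoint : ∀ {A : Set} (xs : List A) {ys x} → Unique (xs ++ ys) → x ∈ xs → x ∉ ys
Unique-++-disjoint (x ∷ xs) (x∉ ∷ u) (here refl) x∈ys = All.lookup (AllP.++⁻ʳ xs x∉) x∈ys refl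
Unique-++-disjoint (y ∷ xs) (_ ∷ u)  (there x∈xs) x∈ys = Unique-++-disjoint xs u x∈xs x∈ys

↭-AllPairs-unique : ∀ {A : Set} {R : A → A → Set} → (∀ {x y} → R x y → ¬ R y x) →
                    ∀ {xs ys} → AllPairs R xs → AllPairs R ys → xs ↭ ys → xs ≡ ys
↭-AllPairs-unique asym {[]}     {[]}     _ _ _ = refl
↭-AllPairs-unique asym {[]}     {y ∷ ys} _ _ p with PermP.↭-empty-inv (↭-sym p)
... | ()
↭-AllPairs-unique asym {x ∷ xs} {[]}     _ _ p with PermP.↭-empty-inv p
... | ()
↭-AllPairs-unique asym {x ∷ xs} {y ∷ ys} (x< ∷ sxs) (y< ∷ sys) p
  with PermP.∈-resp-↭ p (here refl) | PermP.∈-resp-↭ (↭-sym p) (here refl)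
... | here refl  | _          = cong (x ∷_) (↭-AllPairs-unique asym sxs sys (PermP.drop-∷ p))
... | there _    | here refl  = cong (y ∷_) (↭-AllPairs-unique asym sxs sys (PermP.drop-∷ p))
... | there x∈ys | there y∈xs = ⊥-elim (asym (All.lookup x< y∈xs) (All.lookup y< x∈ys))

[]≢snoc : ∀ {A : Set} (xs : List A) {y} → [] ≢ xs ++ [ y ]
[]≢snoc []      ()
[]≢snoc (_ ∷ _) ()

∈⇒↭∷ : ∀ {A : Set} {x : A} {xs} → x ∈ xs → Σ (List A) λ ys → xs ↭ x ∷ ys
∈⇒↭∷ {xs = x ∷ xs} (here refl) = xs , refl
∈⇒↭∷ {xs = y ∷ xs} (there x∈xs) with ∈⇒↭∷ x∈xs
... | ys , p = y ∷ ys , ↭-trans (prep y p) (swap y _ refl)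

∈₂⇒↭∷∷ : ∀ {A : Set} {x y : A} {xs} → x ∈ xs → y ∈ xs → x ≢ y → Σ (List A) λ ys → xs ↭ x ∷ y ∷ ys
∈₂⇒↭∷∷ x∈xs y∈xs x≢y with ∈⇒↭∷ x∈xs
... | ys , p with PermP.∈-resp-↭ p y∈xs
...   | here y≡x   = ⊥-elim (x≢y (sym y≡x))
...   | there y∈ys = let zs , q = ∈⇒↭∷ y∈ys in zs , ↭-trans p (prep _ q)

module _ {A B : Set} where

  concatMap-reverse-∷ : ∀ (g : A → List B) x L → concatMap g (reverse (x ∷ L)) ≡ concatMap g (reverse L) ++ g x
  concatMap-reverse-∷ g x L
    rewrite LP.unfold-reverse x L | LP.concatMap-++ g (reverse L) [ x ] | LP.++-identityʳ (g x) = refl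

  concatMap-reverse-cong : ∀ {g g' : A → List B} {L} → All (λ x → g x ≡ g' x) L →
                           concatMap g (reverse L) ≡ concatMap g' (reverse L)
  concatMap-reverse-cong {g} {g'} {L} g≡g' = cong concat (begin
    map g (reverse L)   ≡⟨ LP.reverse-map g L ⟩
    reverse (map g L)   ≡⟨ cong reverse (LP.map-cong-local g≡g') ⟩
    reverse (map g' L)  ≡⟨ LP.reverse-map g' L ⟨
    map g' (reverse L)  ∎)
    where open ≡-Reasoning

-- Traversing an increasing list backwards, the entries below m₀ come last; so if g differs
-- from g' only by an extra final t at m₀ and g' vanishes below m₀, the t stays last.
concatMap-reverse-snoc : ∀ {n} {B : Set} (g g' : Fin n → List B) {m₀ t} {L : List (Fin n)} →
  AllPairs Fin._<_ L → m₀ ∈ L → (∀ {m} → m ≢ m₀ → g m ≡ g' m) → g m₀ ≡ g' m₀ ++ [ t ] →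
  (∀ {m} → m Fin.< m₀ → g' m ≡ []) → concatMap g (reverse L) ≡ concatMap g' (reverse L) ++ [ t ]
concatMap-reverse-snoc g g' {m₀} {t} {x ∷ L} (x< ∷ _) (here refl) g≡g' gm₀ _ = begin
    concatMap g (reverse (x ∷ L))             ≡⟨ concatMap-reverse-∷ g x L ⟩
    concatMap g (reverse L) ++ g x            ≡⟨ cong₂ _++_ (concatMap-reverse-cong (All.map above x<)) gm₀ ⟩
    concatMap g' (reverse L) ++ g' x ++ [ t ] ≡⟨ LP.++-assoc (concatMap g' (reverse L)) (g' x) [ t ] ⟨
    (concatMap g' (reverse L) ++ g' x) ++ [ t ] ≡⟨ cong (_++ [ t ]) (concatMap-reverse-∷ g' x L) ⟨
    concatMap g' (reverse (x ∷ L)) ++ [ t ]   ∎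
  where
  open ≡-Reasoning
  above : ∀ {m} → x Fin.< m → g m ≡ g' m
  above x<m = g≡g' (λ m≡x → FinP.<-irrefl (sym m≡x) x<m)
concatMap-reverse-snoc g g' {m₀} {t} {x ∷ L} (x< ∷ sorted) (there m₀∈L) g≡g' gm₀ g'< = begin
    concatMap g (reverse (x ∷ L))                ≡⟨ concatMap-reverse-∷ g x L ⟩
    concatMap g (reverse L) ++ g x               ≡⟨ cong₂ _++_ (concatMap-reverse-snoc g g' sorted m₀∈L g≡g' gm₀ g'<) gx≡[] ⟩
    (concatMap g' (reverse L) ++ [ t ]) ++ []    ≡⟨ LP.++-identityʳ _ ⟩
    concatMap g' (reverse L) ++ [ t ]            ≡⟨ cong (_++ [ t ]) (LP.++-identityʳ _) ⟨
    (concatMap g' (reverse L) ++ []) ++ [ t ]    ≡⟨ cong (λ xs → (concatMap g' (reverse L) ++ xs) ++ [ t ]) g'x≡[] ⟨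
    (concatMap g' (reverse L) ++ g' x) ++ [ t ]  ≡⟨ cong (_++ [ t ]) (concatMap-reverse-∷ g' x L) ⟨
    concatMap g' (reverse (x ∷ L)) ++ [ t ]      ∎
  where
  open ≡-Reasoning
  x<m₀ = All.lookup x< m₀∈L
  g'x≡[] = g'< x<m₀
  gx≡[] : g x ≡ []
  gx≡[] = trans (g≡g' (λ x≡m₀ → FinP.<-irrefl x≡m₀ x<m₀)) g'x≡[]

minF≤ˡ : ∀ {n} (i j : Fin n) → minF i j Fin.≤ i
minF≤ˡ i j with toℕ i ≤ᵇ toℕ j in eq
... | true  = ℕP.≤-refl
... | false = ℕP.<⇒≤ (ℕP.≰⇒> (λ i≤j → subst T eq (ℕP.≤⇒≤ᵇ i≤j)))

minF≤ʳ : ∀ {n} (i j : Fin n) → minF i j Fin.≤ j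
minF≤ʳ i j with toℕ i ≤ᵇ toℕ j in eq
... | true  = ℕP.≤ᵇ⇒≤ (toℕ i) (toℕ j) (subst T (sym eq) tt)
... | false = ℕP.≤-refl

minF-sel : ∀ {n} (i j : Fin n) → minF i j ≡ i ⊎ minF i j ≡ j
minF-sel i j with toℕ i ≤ᵇ toℕ j
... | true  = inj₁ refl
... | false = inj₂ refl

minF≡ˡ : ∀ {n} {i j : Fin n} → i Fin.≤ j → minF i j ≡ i
minF≡ˡ {i = i} {j} i≤j with toℕ i ≤ᵇ toℕ j in eq
... | true  = refl
... | false = ⊥-elim (subst T eq (ℕP.≤⇒≤ᵇ i≤j))

pointOf : ∀ {n} → Tree n → Fin n
pointOf (leaf i)         = i
pointOf (node true l r)  = pointOf l
pointOf (node false l r) = pointOf r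

-- λ_• of the merge performed at an internal vertex; leaves get a junk label
label : ∀ {n} → Tree n → Label n
label (leaf i)     = lab i i true
label (node c l r) = lab (ν l) (ν r) c

IsLeaf : ∀ {n} → Tree n → Set
IsLeaf (leaf _)     = ⊤
IsLeaf (node _ _ _) = ⊥

ν∈leaves : ∀ {n} (t : Tree n) → ν t ∈ leaves t
ν∈leaves (leaf i) = here refl
ν∈leaves (node c l r) with minF-sel (ν l) (ν r)
... | inj₁ e rewrite e = ∈-++⁺ˡ (ν∈leaves l)
... | inj₂ e rewrite e = ∈-++⁺ʳ (leaves l) (ν∈leaves r)

ν≤leaves : ∀ {n} (t : Tree n) {i} → i ∈ leaves t → ν t Fin.≤ i
ν≤leaves (leaf i) (here refl) = ℕP.≤-refl
ν≤leaves (node c l r) i∈t with ∈-++⁻ (leaves l) i∈t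
... | inj₁ i∈l = ℕP.≤-trans (minF≤ˡ (ν l) (ν r)) (ν≤leaves l i∈l)
... | inj₂ i∈r = ℕP.≤-trans (minF≤ʳ (ν l) (ν r)) (ν≤leaves r i∈r)

pointOf∈leaves : ∀ {n} (t : Tree n) → pointOf t ∈ leaves t
pointOf∈leaves (leaf i)         = here refl
pointOf∈leaves (node true l r)  = ∈-++⁺ˡ (pointOf∈leaves l)
pointOf∈leaves (node false l r) = ∈-++⁺ʳ (leaves l) (pointOf∈leaves r)

postorder-ν≥ : ∀ {n} (t : Tree n) → All (λ v → ν t Fin.≤ ν v) (postorder t)
postorder-ν≥ (leaf i) = []
postorder-ν≥ (node c l r) =
  AllP.++⁺ (All.map (ℕP.≤-trans (minF≤ˡ (ν l) (ν r))) (postorder-ν≥ l))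
           (AllP.++⁺ (All.map (ℕP.≤-trans (minF≤ʳ (ν l) (ν r))) (postorder-ν≥ r)) (ℕP.≤-refl ∷ []))

postorder-ν∈leaves : ∀ {n} (t : Tree n) → All (λ v → ν v ∈ leaves t) (postorder t)
postorder-ν∈leaves (leaf i) = []
postorder-ν∈leaves (node c l r) =
  AllP.++⁺ (All.map ∈-++⁺ˡ (postorder-ν∈leaves l))
           (AllP.++⁺ (All.map (∈-++⁺ʳ (leaves l)) (postorder-ν∈leaves r)) (ν∈leaves (node c l r) ∷ []))

-- Forests and their pointed partitions

record DistinctLeaves {n} (F : Forest n) : Set where
  constructor distinctLeaves
  field distinct : Unique (forestLeaves F)

record Covers n (F : Forest n) : Set where
  constructor covers
  field leaves↭allFin : forestLeaves F ↭ allFin n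

open Covers

module _ {n : ℕ} where

  DistinctLeaves-tail : ∀ {t : Tree n} {R} → DistinctLeaves (t ∷ R) → DistinctLeaves R
  DistinctLeaves-tail {t} (distinctLeaves u) = distinctLeaves (Unique-++⁻ʳ (leaves t) u)

  DistinctLeaves-resp-↭ : ∀ {F G : Forest n} → F ↭ G → DistinctLeaves F → DistinctLeaves G
  DistinctLeaves-resp-↭ p (distinctLeaves u) = distinctLeaves (Unique-resp-↭ (concatMap-↭ leaves p) u)

  Covers⇒DistinctLeaves : ∀ {F : Forest n} → Covers n F → DistinctLeaves F
  Covers⇒DistinctLeaves (covers p) = distinctLeaves (Unique-resp-↭ (↭-sym p) (UniqueP.allFin⁺ n))

  Covers-resp-↭ : ∀ {F G : Forest n} → F ↭ G → Covers n F → Covers n G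
  Covers-resp-↭ p (covers q) = covers (↭-trans (↭-sym (concatMap-↭ leaves p)) q)

  Covers⇒tree : ∀ {F : Forest n} → Covers n F → ∀ i → Σ (Tree n) λ s → s ∈ F × i ∈ leaves s
  Covers⇒tree (covers p) i = find (∈-concatMap⁻ leaves (PermP.∈-resp-↭ (↭-sym p) (∈-allFin i)))

  headDisjoint : ∀ {t s : Tree n} {R i} → DistinctLeaves (t ∷ R) → s ∈ R →
                 i ∈ leaves t → i ∉ leaves s
  headDisjoint {t} (distinctLeaves u) s∈R i∈t i∈s =
    Unique-++-disjoint (leaves t) u i∈t (∈-concatMap⁺ leaves (lose s∈R i∈s))

  sameTree : ∀ {F : Forest n} {s s' i} → DistinctLeaves F → s ∈ F → s' ∈ F →
             i ∈ leaves s → i ∈ leaves s' → s ≡ s'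
  sameTree d (here refl) (here refl)   i∈s i∈s' = refl
  sameTree d (here refl) (there s'∈R)  i∈s i∈s' = ⊥-elim (headDisjoint d s'∈R i∈s i∈s')
  sameTree d (there s∈R) (here refl)   i∈s i∈s' = ⊥-elim (headDisjoint d s∈R i∈s' i∈s)
  sameTree d (there s∈R) (there s'∈R)  i∈s i∈s' = sameTree (DistinctLeaves-tail d) s∈R s'∈R i∈s i∈s'

  forestLeaves-node : ∀ c (l r : Tree n) R → forestLeaves (node c l r ∷ R) ≡ forestLeaves (l ∷ r ∷ R)
  forestLeaves-node c l r R = LP.++-assoc (leaves l) (leaves r) (forestLeaves R)

  Covers-unnode : ∀ {c} {l r : Tree n} {R} → Covers n (node c l r ∷ R) → Covers n (l ∷ r ∷ R)
  Covers-unnode {c} {l} {r} {R} (covers p) = covers (subst (_↭ allFin n) (forestLeaves-node c l r R) p)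

  Covers-node : ∀ c {l r : Tree n} {R} → Covers n (l ∷ r ∷ R) → Covers n (node c l r ∷ R)
  Covers-node c {l} {r} {R} (covers p) = covers (subst (_↭ allFin n) (sym (forestLeaves-node c l r R)) p)

module _ {n : ℕ} where

  _∈?_ : (i : Fin n) (xs : List (Fin n)) → Dec (i ∈ xs)
  i ∈? xs = Any.any? (i ≟_) xs

  pointIn : Forest n → Fin n → Fin n
  pointIn []      i = i
  pointIn (t ∷ F) i with i ∈? leaves t
  ... | yes _ = pointOf t
  ... | no  _ = pointIn F i

  partOf : Forest n → Part n
  partOf F = tabulate (pointIn F)

  lookup-partOf : ∀ {F s i} → DistinctLeaves F → s ∈ F → i ∈ leaves s → lookup (partOf F) i ≡ pointOf s
  lookup-partOf {F} {s} {i} d s∈F i∈s = trans (VecP.lookup∘tabulate (pointIn F) i) (pointIn-∈ d s∈F i∈s)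
    where
    pointIn-∈ : ∀ {F} → DistinctLeaves F → s ∈ F → i ∈ leaves s → pointIn F i ≡ pointOf s
    pointIn-∈ {t ∷ F} d (here refl) i∈s with i ∈? leaves t
    ... | yes _   = refl
    ... | no  i∉t = ⊥-elim (i∉t i∈s)
    pointIn-∈ {t ∷ F} d (there s∈F) i∈s with i ∈? leaves t
    ... | yes i∈t = ⊥-elim (headDisjoint d s∈F i∈t i∈s)
    ... | no  _   = pointIn-∈ (DistinctLeaves-tail d) s∈F i∈s

  partOf-pointOf : ∀ {F s} → DistinctLeaves F → s ∈ F → lookup (partOf F) (pointOf s) ≡ pointOf s
  partOf-pointOf {s = s} d s∈F = lookup-partOf d s∈F (pointOf∈leaves s)

  partOf-ν : ∀ {F s} → DistinctLeaves F → s ∈ F → lookup (partOf F) (ν s) ≡ pointOf s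
  partOf-ν {s = s} d s∈F = lookup-partOf d s∈F (ν∈leaves s)

  partOf-ext : ∀ {F} {π : Part n} → Covers n F →
               (∀ {s i} → s ∈ F → i ∈ leaves s → pointOf s ≡ lookup π i) → partOf F ≡ π
  partOf-ext {F} cv h = Pointwise.Pointwise-≡⇒≡ (Pointwise.ext λ i →
    let s , s∈F , i∈s = Covers⇒tree cv i
    in trans (lookup-partOf (Covers⇒DistinctLeaves cv) s∈F i∈s) (h s∈F i∈s))

  partOf-resp-↭ : ∀ {F G} → Covers n F → F ↭ G → partOf F ≡ partOf G
  partOf-resp-↭ cv p = partOf-ext cv λ s∈F i∈s →
    sym (lookup-partOf (Covers⇒DistinctLeaves (Covers-resp-↭ p cv)) (PermP.∈-resp-↭ p s∈F) i∈s)

  partOf-leaves : ∀ {F} → Covers n F → All IsLeaf F → partOf F ≡ zeroP n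
  partOf-leaves cv leafF = partOf-ext cv λ s∈F i∈s →
    trans (pointOf-leaf _ (All.lookup leafF s∈F) i∈s) (sym (VecP.lookup-allFin _))
    where
    pointOf-leaf : ∀ s {i} → IsLeaf s → i ∈ leaves s → pointOf s ≡ i
    pointOf-leaf (leaf j) _ (here refl) = refl

  partOf-isPointedPartition : ∀ {F} → Covers n F → IsPointedPartition (partOf F)
  partOf-isPointedPartition {F} cv i =
    let s , s∈F , i∈s = Covers⇒tree cv i
        d = Covers⇒DistinctLeaves cv
    in trans (cong (lookup (partOf F)) (lookup-partOf d s∈F i∈s))
             (trans (partOf-pointOf d s∈F) (sym (lookup-partOf d s∈F i∈s)))

  partOf-blockMin : ∀ {F s} → Covers n F → s ∈ F → IsBlockMin (partOf F) (pointOf s) (ν s)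
  partOf-blockMin {F} {s} cv s∈F = partOf-ν d s∈F , ν≤block
    where
    d = Covers⇒DistinctLeaves cv
    ν≤block : ∀ j → lookup (partOf F) j ≡ pointOf s → ν s Fin.≤ j
    ν≤block j j↦s with Covers⇒tree cv j
    ... | s' , s'∈F , j∈s'
      with sameTree d s'∈F s∈F (pointOf∈leaves s')
             (subst (_∈ leaves s) (sym (trans (sym (lookup-partOf d s'∈F j∈s')) j↦s)) (pointOf∈leaves s))
    ... | refl = ν≤leaves s j∈s'

  pointOf-headDisjoint : ∀ {t s : Tree n} {R} → DistinctLeaves (t ∷ R) → s ∈ R → pointOf t ≢ pointOf s
  pointOf-headDisjoint {t} {s} d s∈R e =
    headDisjoint d s∈R (pointOf∈leaves t) (subst (_∈ leaves s) (sym e) (pointOf∈leaves s))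

  pointOf-injective : ∀ {F} {s s' : Tree n} → DistinctLeaves F → s ∈ F → s' ∈ F → pointOf s ≡ pointOf s' → s ≡ s'
  pointOf-injective {s = s} {s'} d s∈F s'∈F e =
    sameTree d s∈F s'∈F (pointOf∈leaves s) (subst (_∈ leaves s') (sym e) (pointOf∈leaves s'))

  mergeMap : Fin n → Fin n → Fin n → Fin n
  mergeMap p q x = if does (x ≟ p) ∨ does (x ≟ q) then p else x

  lookup-merge : ∀ (π : Part n) p q i → lookup (merge π p q) i ≡ mergeMap p q (lookup π i)
  lookup-merge π p q i = VecP.lookup-map i (mergeMap p q) π

  mergeMap-cases : ∀ p q x → (mergeMap p q x ≡ p × (x ≡ p ⊎ x ≡ q)) ⊎ (mergeMap p q x ≡ x × x ≢ p × x ≢ q)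
  mergeMap-cases p q x with x ≟ p
  ... | yes x≡p = inj₁ (refl , inj₁ x≡p)
  ... | no  x≢p with x ≟ q
  ... | yes x≡q = inj₁ (refl , inj₂ x≡q)
  ... | no  x≢q = inj₂ (refl , x≢p , x≢q)

  mergeMap-joined : ∀ {p q x} → x ≡ p ⊎ x ≡ q → mergeMap p q x ≡ p
  mergeMap-joined {p} {q} {x} x∈pq with mergeMap-cases p q x
  ... | inj₁ (e , _)            = e
  ... | inj₂ (_ , x≢p , x≢q) with x∈pq
  ...   | inj₁ x≡p = ⊥-elim (x≢p x≡p)
  ...   | inj₂ x≡q = ⊥-elim (x≢q x≡q)

  mergeMap-other : ∀ {p q x} → x ≢ p → x ≢ q → mergeMap p q x ≡ x
  mergeMap-other {p} {q} {x} x≢p x≢q with mergeMap-cases p q x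
  ... | inj₁ (_ , inj₁ x≡p) = ⊥-elim (x≢p x≡p)
  ... | inj₁ (_ , inj₂ x≡q) = ⊥-elim (x≢q x≡q)
  ... | inj₂ (e , _)        = e

  mergeBy : Bool → Part n → Fin n → Fin n → Part n
  mergeBy u π p q = if u then merge π p q else merge π q p

  lookup-mergeBy-joined : ∀ u π {p q} i → lookup π i ≡ p ⊎ lookup π i ≡ q →
                          lookup (mergeBy u π p q) i ≡ (if u then p else q)
  lookup-mergeBy-joined true  π i j = trans (lookup-merge π _ _ i) (mergeMap-joined j)
  lookup-mergeBy-joined false π i j = trans (lookup-merge π _ _ i) (mergeMap-joined (⊎-swap j))

  lookup-mergeBy-other : ∀ u π {p q} i → lookup π i ≢ p → lookup π i ≢ q →
                         lookup (mergeBy u π p q) i ≡ lookup π i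
  lookup-mergeBy-other true  π i ≢p ≢q = trans (lookup-merge π _ _ i) (mergeMap-other ≢p ≢q)
  lookup-mergeBy-other false π i ≢p ≢q = trans (lookup-merge π _ _ i) (mergeMap-other ≢q ≢p)

  mergeStep-node : ∀ π c (l r : Tree n) → lookup π (ν l) ≡ pointOf l → lookup π (ν r) ≡ pointOf r →
                   mergeStep π (node c l r) ≡ mergeBy c π (pointOf l) (pointOf r)
  mergeStep-node π true  l r eˡ eʳ rewrite eˡ | eʳ = refl
  mergeStep-node π false l r eˡ eʳ rewrite eˡ | eʳ = refl

  pointOf-node : ∀ c (l r : Tree n) → pointOf (node c l r) ≡ (if c then pointOf l else pointOf r)
  pointOf-node true  l r = refl
  pointOf-node false l r = refl

  partOf-node : ∀ c {l r : Tree n} {R} → Covers n (l ∷ r ∷ R) →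
                partOf (node c l r ∷ R) ≡ mergeStep (partOf (l ∷ r ∷ R)) (node c l r)
  partOf-node c {l} {r} {R} cv = begin
      partOf (node c l r ∷ R)
    ≡⟨ partOf-ext (Covers-node c cv) pointOf≡ ⟩
      mergeBy c π (pointOf l) (pointOf r)
    ≡⟨ sym (mergeStep-node π c l r (partOf-ν d (here refl)) (partOf-ν d (there (here refl)))) ⟩
      mergeStep π (node c l r) ∎
    where
    open ≡-Reasoning
    π = partOf (l ∷ r ∷ R)
    d = Covers⇒DistinctLeaves cv
    pointOf≡ : ∀ {s i} → s ∈ node c l r ∷ R → i ∈ leaves s →
               pointOf s ≡ lookup (mergeBy c π (pointOf l) (pointOf r)) i
    pointOf≡ (here refl) i∈t with ∈-++⁻ (leaves l) i∈t
    ... | inj₁ i∈l = trans (pointOf-node c l r)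
          (sym (lookup-mergeBy-joined c π _ (inj₁ (lookup-partOf d (here refl) i∈l))))
    ... | inj₂ i∈r = trans (pointOf-node c l r)
          (sym (lookup-mergeBy-joined c π _ (inj₂ (lookup-partOf d (there (here refl)) i∈r))))
    pointOf≡ {s} (there s∈R) i∈s = sym (trans
      (lookup-mergeBy-other c π _ (λ e → pointOf-headDisjoint d (there s∈R) (sym (trans (sym π≡) e)))
                                  (λ e → pointOf-headDisjoint (DistinctLeaves-tail d) s∈R (sym (trans (sym π≡) e))))
      π≡)
      where π≡ = lookup-partOf d (there (there s∈R)) i∈s

  -- The reverse-minimal linear extension

  internalVertices : Forest n → List (Tree n)
  internalVertices = concatMap postorder

  layer : Fin n → List (Tree n) → List (Tree n)
  layer m = filter (λ v → ν v ≟ m)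

  RootAtLeast : Fin n → Tree n → Set
  RootAtLeast m (leaf _)         = ⊤
  RootAtLeast m t@(node _ _ _)   = m Fin.≤ ν t

  ≤ν⇒RootAtLeast : ∀ {m} t → m Fin.≤ ν t → RootAtLeast m t
  ≤ν⇒RootAtLeast (leaf _)       _   = tt
  ≤ν⇒RootAtLeast (node _ _ _) m≤ν = m≤ν

  internalVertices-ν≥ : ∀ {m} F → All (RootAtLeast m) F → All (λ v → m Fin.≤ ν v) (internalVertices F)
  internalVertices-ν≥ []                 []        = []
  internalVertices-ν≥ (leaf _ ∷ F)       (_ ∷ ≥F)  = internalVertices-ν≥ F ≥F
  internalVertices-ν≥ (t@(node _ _ _) ∷ F) (m≤ ∷ ≥F) =
    AllP.++⁺ (All.map (ℕP.≤-trans m≤) (postorder-ν≥ t)) (internalVertices-ν≥ F ≥F)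

  layer-tree-∉ : ∀ {m} t → m ∉ leaves t → layer m (postorder t) ≡ []
  layer-tree-∉ {m} t m∉t =
    LP.filter-none (λ v → ν v ≟ m) (All.map (λ ν∈t ν≡m → m∉t (subst (_∈ leaves t) ν≡m ν∈t)) (postorder-ν∈leaves t))

  layer-forest-∉ : ∀ {m} F → m ∉ forestLeaves F → layer m (internalVertices F) ≡ []
  layer-forest-∉ {m} F m∉F = LP.filter-none (λ v → ν v ≟ m) (All.tabulate ν≢m)
    where
    ν≢m : ∀ {v} → v ∈ internalVertices F → ν v ≢ m
    ν≢m v∈ refl with find (∈-concatMap⁻ postorder {xs = F} v∈)
    ... | s , s∈F , v∈s = m∉F (∈-concatMap⁺ leaves (lose s∈F (All.lookup (postorder-ν∈leaves s) v∈s)))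

  layer-forest : ∀ {m F s} → DistinctLeaves F → s ∈ F → m ∈ leaves s →
                 layer m (internalVertices F) ≡ layer m (postorder s)
  layer-forest {m} {t ∷ F} d (here refl) m∈t = begin
      layer m (postorder t ++ internalVertices F)            ≡⟨ LP.filter-++ _ (postorder t) _ ⟩
      layer m (postorder t) ++ layer m (internalVertices F)  ≡⟨ cong (_ ++_) (layer-forest-∉ F m∉F) ⟩
      layer m (postorder t) ++ []                            ≡⟨ LP.++-identityʳ _ ⟩
      layer m (postorder t)                                  ∎
    where
    open ≡-Reasoning
    m∉F : m ∉ forestLeaves F
    m∉F m∈F with find (∈-concatMap⁻ leaves {xs = F} m∈F)
    ... | s , s∈F , m∈s = headDisjoint d s∈F m∈t m∈s
  layer-forest {m} {t ∷ F} {s} d (there s∈F) m∈s = begin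
      layer m (postorder t ++ internalVertices F)            ≡⟨ LP.filter-++ _ (postorder t) _ ⟩
      layer m (postorder t) ++ layer m (internalVertices F)  ≡⟨ cong₂ _++_ (layer-tree-∉ t (λ m∈t → headDisjoint d s∈F m∈t m∈s))
                                                                         (layer-forest (DistinctLeaves-tail d) s∈F m∈s) ⟩
      layer m (postorder s)                                  ∎
    where open ≡-Reasoning

  revMinLinExt-resp-↭ : ∀ {F G} → Covers n F → F ↭ G → revMinLinExt F ≡ revMinLinExt G
  revMinLinExt-resp-↭ {F} {G} cv p = LP.concatMap-cong layer≡ (reverse (allFin n))
    where
    layer≡ : ∀ m → layer m (internalVertices F) ≡ layer m (internalVertices G)
    layer≡ m with Covers⇒tree cv m
    ... | s , s∈F , m∈s = trans (layer-forest (Covers⇒DistinctLeaves cv) s∈F m∈s)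
      (sym (layer-forest (Covers⇒DistinctLeaves (Covers-resp-↭ p cv)) (PermP.∈-resp-↭ p s∈F) m∈s))

  internalVertices-leaves : ∀ {F} → All IsLeaf F → internalVertices F ≡ []
  internalVertices-leaves {[]}         []          = refl
  internalVertices-leaves {leaf _ ∷ F} (_ ∷ leafF) = internalVertices-leaves leafF

  revMinLinExt-leaves : ∀ {F} → All IsLeaf F → revMinLinExt F ≡ []
  revMinLinExt-leaves leafF rewrite internalVertices-leaves leafF = noLayers (reverse (allFin n))
    where
    noLayers : ∀ ms → concatMap (λ m → layer m []) ms ≡ []
    noLayers []       = refl
    noLayers (_ ∷ ms) = noLayers ms

  layer-node : ∀ m c (l r : Tree n) R → layer m (internalVertices (node c l r ∷ R)) ≡
               layer m (postorder l) ++ layer m (postorder r) ++ layer m [ node c l r ] ++ layer m (internalVertices R)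
  layer-node m c l r R
    rewrite LP.filter-++ (λ v → ν v ≟ m) (postorder l ++ postorder r ++ [ node c l r ]) (internalVertices R)
          | LP.filter-++ (λ v → ν v ≟ m) (postorder l) (postorder r ++ [ node c l r ])
          | LP.filter-++ (λ v → ν v ≟ m) (postorder r) [ node c l r ]
          | LP.++-assoc (layer m (postorder l)) (layer m (postorder r) ++ layer m [ node c l r ]) (layer m (internalVertices R))
          | LP.++-assoc (layer m (postorder r)) (layer m [ node c l r ]) (layer m (internalVertices R)) = refl

  layer-children : ∀ m (l r : Tree n) R → layer m (internalVertices (l ∷ r ∷ R)) ≡
                   layer m (postorder l) ++ layer m (postorder r) ++ layer m (internalVertices R)
  layer-children m l r R
    rewrite LP.filter-++ (λ v → ν v ≟ m) (postorder l) (postorder r ++ internalVertices R)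
          | LP.filter-++ (λ v → ν v ≟ m) (postorder r) (internalVertices R) = refl

  revMinLinExt-node : ∀ c (l r : Tree n) R → DistinctLeaves (node c l r ∷ R) → All (RootAtLeast (ν (node c l r))) R →
                      revMinLinExt (node c l r ∷ R) ≡ revMinLinExt (l ∷ r ∷ R) ++ [ node c l r ]
  revMinLinExt-node c l r R d ≥R =
    concatMap-reverse-snoc (λ m → layer m (internalVertices F)) (λ m → layer m (internalVertices F'))
      (AllPairsP.tabulate⁺-< (λ i<j → i<j)) (∈-allFin m₀) otherLayer ownLayer lowerLayer
    where
    open ≡-Reasoning
    t  = node c l r
    m₀ = ν t
    F  = t ∷ R
    F' = l ∷ r ∷ R
    Ll = layer m₀ (postorder l)
    Lr = layer m₀ (postorder r)
    LR = layer m₀ (internalVertices R)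
    LR≡[] : LR ≡ []
    LR≡[] = layer-forest-∉ R λ m₀∈R →
      let s , s∈R , m₀∈s = find (∈-concatMap⁻ leaves {xs = R} m₀∈R) in headDisjoint d s∈R (ν∈leaves t) m₀∈s
    otherLayer : ∀ {m} → m ≢ m₀ → layer m (internalVertices F) ≡ layer m (internalVertices F')
    otherLayer {m} m≢m₀ rewrite layer-node m c l r R | layer-children m l r R
      | LP.filter-reject (λ v → ν v ≟ m) {x = t} {xs = []} (λ m₀≡m → m≢m₀ (sym m₀≡m)) = refl
    ownLayer : layer m₀ (internalVertices F) ≡ layer m₀ (internalVertices F') ++ [ t ]
    ownLayer = begin
      layer m₀ (internalVertices F)     ≡⟨ layer-node m₀ c l r R ⟩
      Ll ++ Lr ++ layer m₀ [ t ] ++ LR  ≡⟨ cong (λ xs → Ll ++ Lr ++ xs ++ LR) (LP.filter-accept (λ v → ν v ≟ m₀) {x = t} {xs = []} refl) ⟩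
      Ll ++ Lr ++ [ t ] ++ LR           ≡⟨ cong (λ xs → Ll ++ Lr ++ [ t ] ++ xs) LR≡[] ⟩
      Ll ++ Lr ++ [ t ]                 ≡⟨ LP.++-assoc Ll Lr [ t ] ⟨
      (Ll ++ Lr) ++ [ t ]               ≡⟨ cong (λ xs → (Ll ++ xs) ++ [ t ]) (LP.++-identityʳ Lr) ⟨
      (Ll ++ Lr ++ []) ++ [ t ]         ≡⟨ cong (λ xs → (Ll ++ Lr ++ xs) ++ [ t ]) LR≡[] ⟨
      (Ll ++ Lr ++ LR) ++ [ t ]         ≡⟨ cong (_++ [ t ]) (layer-children m₀ l r R) ⟨
      layer m₀ (internalVertices F') ++ [ t ] ∎
    lowerLayer : ∀ {m} → m Fin.< m₀ → layer m (internalVertices F') ≡ []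
    lowerLayer {m} m<m₀ = LP.filter-none (λ v → ν v ≟ m)
      (All.map (λ m₀≤ν ν≡m → FinP.<-irrefl (sym ν≡m) (ℕP.<-≤-trans m<m₀ m₀≤ν))
               (internalVertices-ν≥ F' (≤ν⇒RootAtLeast l (minF≤ˡ (ν l) (ν r)) ∷ ≤ν⇒RootAtLeast r (minF≤ʳ (ν l) (ν r)) ∷ ≥R)))

  -- Peeling off the root of least valency

  record Split (F : Forest n) : Set where
    constructor split
    field
      colour      : Bool
      left right  : Tree n
      rest        : Forest n
      perm        : F ↭ node colour left right ∷ rest
      rootMinimal : All (RootAtLeast (ν (node colour left right))) rest

    root : Tree n
    root = node colour left right

    children : Forest n
    children = left ∷ right ∷ rest

  open Split public

  RootAtLeast-weaken : ∀ {m m'} t → m Fin.≤ m' → RootAtLeast m' t → RootAtLeast m t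
  RootAtLeast-weaken (leaf _)     _    _     = tt
  RootAtLeast-weaken (node _ _ _) m≤m' m'≤ν = ℕP.≤-trans m≤m' m'≤ν

  leaf⇒RootAtLeast : ∀ {m} t → IsLeaf t → RootAtLeast m t
  leaf⇒RootAtLeast (leaf _) _ = tt

  split? : (F : Forest n) → All IsLeaf F ⊎ Split F
  split? [] = inj₁ []
  split? (leaf i ∷ F) with split? F
  ... | inj₁ leafF = inj₁ (tt ∷ leafF)
  ... | inj₂ (split c l r R p ≥R) =
    inj₂ (split c l r (leaf i ∷ R) (↭-trans (prep (leaf i) p) (swap (leaf i) (node c l r) refl)) (tt ∷ ≥R))
  split? (t@(node c l r) ∷ F) with split? F
  ... | inj₁ leafF = inj₂ (split c l r F refl (All.map (leaf⇒RootAtLeast _) leafF))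
  ... | inj₂ (split c' l' r' R p ≥R) with toℕ (ν t) ℕ.≤? toℕ (ν (node c' l' r'))
  ...   | yes t≤t' = inj₂ (split c l r F refl
          (PermP.All-resp-↭ (↭-sym p) (t≤t' ∷ All.map (λ {s} → RootAtLeast-weaken s t≤t') ≥R)))
  ...   | no  t≰t' = inj₂ (split c' l' r' (t ∷ R) (↭-trans (prep t p) (swap t (node c' l' r') refl))
          (ℕP.<⇒≤ (ℕP.≰⇒> t≰t') ∷ ≥R))

  Covers-children : ∀ {F} → Covers n F → (s : Split F) → Covers n (children s)
  Covers-children cv s = Covers-unnode (Covers-resp-↭ (perm s) cv)

  forestSize : Forest n → ℕ
  forestSize F = length (internalVertices F)

  forestSize-children : ∀ {F} (s : Split F) → forestSize F ≡ suc (forestSize (children s))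
  forestSize-children {F} (split c l r R p _) = begin
      length (internalVertices F)                          ≡⟨ PermP.↭-length (concatMap-↭ postorder p) ⟩
      length ((pl ++ pr ++ [ t ]) ++ ivR)                  ≡⟨ cong length (LP.++-assoc pl (pr ++ [ t ]) ivR) ⟩
      length (pl ++ (pr ++ [ t ]) ++ ivR)                  ≡⟨ cong (λ xs → length (pl ++ xs)) (LP.++-assoc pr [ t ] ivR) ⟩
      length (pl ++ pr ++ t ∷ ivR)                         ≡⟨ cong length (LP.++-assoc pl pr (t ∷ ivR)) ⟨
      length ((pl ++ pr) ++ t ∷ ivR)                       ≡⟨ LP.length-++-sucʳ (pl ++ pr) t ivR ⟩
      suc (length ((pl ++ pr) ++ ivR))                     ≡⟨ cong (suc ∘ length) (LP.++-assoc pl pr ivR) ⟩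
      suc (length (pl ++ pr ++ ivR))                       ∎
    where
    open ≡-Reasoning
    t   = node c l r
    pl  = postorder l
    pr  = postorder r
    ivR = internalVertices R

  -- replacing the root of least valency by its two subtrees undoes the last step of c(F)
  forest-induction : (P : Forest n → Set) →
    (∀ {F} → Covers n F → All IsLeaf F → P F) →
    (∀ {F} → Covers n F → (s : Split F) → P (children s) → P F) →
    ∀ {F} → Covers n F → P F
  forest-induction P onLeaves onSplit {F} = go (forestSize F) refl
    where
    go : ∀ k {F} → forestSize F ≡ k → Covers n F → P F
    go k {F} size≡k cv with split? F
    go k       size≡k cv | inj₁ leafF = onLeaves cv leafF
    go zero    size≡k cv | inj₂ s = ⊥-elim (ℕP.1+n≢0 (trans (sym (forestSize-children s)) size≡k))
    go (suc k) size≡k cv | inj₂ s =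
      onSplit cv s (go k (ℕP.suc-injective (trans (sym (forestSize-children s)) size≡k)) (Covers-children cv s))

  revMinLinExt-split : ∀ {F} → Covers n F → (s : Split F) → revMinLinExt F ≡ revMinLinExt (children s) ++ [ root s ]
  revMinLinExt-split cv (split c l r R p ≥R) =
    trans (revMinLinExt-resp-↭ cv p) (revMinLinExt-node c l r R (Covers⇒DistinctLeaves (Covers-resp-↭ p cv)) ≥R)

  partOf-split : ∀ {F} → Covers n F → (s : Split F) → partOf F ≡ mergeStep (partOf (children s)) (root s)
  partOf-split cv s = trans (partOf-resp-↭ cv (perm s)) (partOf-node (colour s) (Covers-children cv s))

  top : Part n → List (Tree n) → Part n
  top π []       = π
  top π (v ∷ vs) = top (mergeStep π v) vs

  chainTail : Part n → List (Tree n) → List (Part n)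
  chainTail π []       = []
  chainTail π (v ∷ vs) = runChain (mergeStep π v) vs

  runChain-∷ : ∀ π vs → runChain π vs ≡ π ∷ chainTail π vs
  runChain-∷ π []      = refl
  runChain-∷ π (_ ∷ _) = refl

  top-snoc : ∀ π vs t → top π (vs ++ [ t ]) ≡ mergeStep (top π vs) t
  top-snoc π []       t = refl
  top-snoc π (v ∷ vs) t = top-snoc (mergeStep π v) vs t

  runChain-snoc : ∀ π vs t → runChain π (vs ++ [ t ]) ≡ runChain π vs ++ [ mergeStep (top π vs) t ]
  runChain-snoc π []       t = refl
  runChain-snoc π (v ∷ vs) t = cong (π ∷_) (runChain-snoc (mergeStep π v) vs t)

  ChainFrom-snoc : ∀ π vs t → ChainFrom π (chainTail π vs) (map label vs) →
                   Step (top π vs) (mergeStep (top π vs) t) (label t) →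
                   ChainFrom π (chainTail π (vs ++ [ t ])) (map label (vs ++ [ t ]))
  ChainFrom-snoc π []           t done               stepₜ = step stepₜ done
  ChainFrom-snoc π (v ∷ [])     t (step stepᵥ done)  stepₜ = step stepᵥ (step stepₜ done)
  ChainFrom-snoc π (v ∷ w ∷ vs) t (step stepᵥ chain) stepₜ = step stepᵥ (ChainFrom-snoc (mergeStep π v) (w ∷ vs) t chain stepₜ)

  top-revMinLinExt : ∀ {F} → Covers n F → top (zeroP n) (revMinLinExt F) ≡ partOf F
  top-revMinLinExt = forest-induction (λ F → top (zeroP n) (revMinLinExt F) ≡ partOf F)
    (λ cv leafF → trans (cong (top (zeroP n)) (revMinLinExt-leaves leafF)) (sym (partOf-leaves cv leafF)))
    (λ {F} cv s ih → begin
      top (zeroP n) (revMinLinExt F)                          ≡⟨ cong (top (zeroP n)) (revMinLinExt-split cv s) ⟩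
      top (zeroP n) (revMinLinExt (children s) ++ [ root s ]) ≡⟨ top-snoc (zeroP n) (revMinLinExt (children s)) (root s) ⟩
      mergeStep (top (zeroP n) (revMinLinExt (children s))) (root s) ≡⟨ cong (λ π → mergeStep π (root s)) ih ⟩
      mergeStep (partOf (children s)) (root s)               ≡⟨ partOf-split cv s ⟨
      partOf F                                                ∎)
    where open ≡-Reasoning

  c-leaves : ∀ {F} → All IsLeaf F → c n F ≡ [ zeroP n ]
  c-leaves leafF = cong (runChain (zeroP n)) (revMinLinExt-leaves leafF)

  c-split : ∀ {F} → Covers n F → (s : Split F) → c n F ≡ c n (children s) ++ [ partOf F ]
  c-split {F} cv s = begin
    runChain (zeroP n) (revMinLinExt F)                          ≡⟨ cong (runChain (zeroP n)) (revMinLinExt-split cv s) ⟩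
    runChain (zeroP n) (revMinLinExt (children s) ++ [ root s ]) ≡⟨ runChain-snoc (zeroP n) (revMinLinExt (children s)) (root s) ⟩
    c n (children s) ++ [ mergeStep (top (zeroP n) (revMinLinExt (children s))) (root s) ]
      ≡⟨ cong (λ π → c n (children s) ++ [ mergeStep π (root s) ]) (top-revMinLinExt (Covers-children cv s)) ⟩
    c n (children s) ++ [ mergeStep (partOf (children s)) (root s) ] ≡⟨ cong (λ π → c n (children s) ++ [ π ]) (partOf-split cv s) ⟨
    c n (children s) ++ [ partOf F ]                              ∎
    where open ≡-Reasoning

  c-resp-↭ : ∀ {F G} → Covers n F → F ↭ G → c n F ≡ c n G
  c-resp-↭ cv p = cong (runChain (zeroP n)) (revMinLinExt-resp-↭ cv p)

  -- c(F) is an ascent-free saturated chain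

  ν<ν-of-tail : ∀ {t s : Tree n} {F} → DistinctLeaves (t ∷ F) → s ∈ F → ν t Fin.≤ ν s → ν t Fin.< ν s
  ν<ν-of-tail {t} {s} d s∈F ν≤ν = FinP.≤∧≢⇒< ν≤ν
    (λ ν≡ν → headDisjoint d s∈F (ν∈leaves t) (subst (_∈ leaves s) (sym ν≡ν) (ν∈leaves s)))

  ν-left<ν-right : ∀ c {l r : Tree n} {R} → DistinctLeaves (l ∷ r ∷ R) → ν (node c l r) ≡ ν l → ν l Fin.< ν r
  ν-left<ν-right c {l} {r} d ν≡νl = ν<ν-of-tail d (here refl) (subst (Fin._≤ ν r) ν≡νl (minF≤ʳ (ν l) (ν r)))

  step-node : ∀ c {l r : Tree n} {R} → Covers n (l ∷ r ∷ R) → ν l Fin.< ν r →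
              Step (partOf (l ∷ r ∷ R)) (mergeStep (partOf (l ∷ r ∷ R)) (node c l r)) (label (node c l r))
  step-node c {l} {r} {R} cv νl<νr =
    partOf-isPointedPartition cv , νl<νr , pointOf l , pointOf r ,
    partOf-pointOf d (here refl) , partOf-pointOf d (there (here refl)) ,
    partOf-blockMin cv (here refl) , partOf-blockMin cv (there (here refl)) ,
    mergeStep-node (partOf (l ∷ r ∷ R)) c l r (partOf-ν d (here refl)) (partOf-ν d (there (here refl)))
    where d = Covers⇒DistinctLeaves cv

  ≮Λ-by-a : ∀ {a b a' b' : Fin n} {u u'} → a' Fin.< a → ¬ (lab a b u <Λ lab a' b' u')
  ≮Λ-by-a a'<a (diff-a a<a') = FinP.<-asym a'<a a<a'
  ≮Λ-by-a a'<a A<C           = FinP.<-irrefl refl a'<a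
  ≮Λ-by-a a'<a (inC _)       = FinP.<-irrefl refl a'<a

  ≮Λ-same-a : ∀ {a b b' : Fin n} {u u'} → u' ≤𝔹 u → (u ≡ true → u' ≡ true → b' Fin.< b) → ¬ (lab a b u <Λ lab a b' u')
  ≮Λ-same-a u'≤u b'<b (diff-a a<a) = FinP.<-irrefl refl a<a
  ≮Λ-same-a ()    b'<b A<C
  ≮Λ-same-a u'≤u b'<b (inC b<b')   = FinP.<-asym b<b' (b'<b refl refl)

  labels : Forest n → List (Label n)
  labels F = map label (revMinLinExt F)

  labels-split : ∀ {F} → Covers n F → (s : Split F) → labels F ≡ labels (children s) ++ [ label (root s) ]
  labels-split cv s = trans (cong (map label) (revMinLinExt-split cv s)) (LP.map-++ label (revMinLinExt (children s)) _)

  root-∈ : ∀ {F} (s : Split F) → root s ∈ F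
  root-∈ s = PermP.∈-resp-↭ (↭-sym (perm s)) (here refl)

NoAscent-snoc : ∀ {n} (xs : List (Label n)) {y z} → NoAscent (xs ++ [ y ]) → ¬ (y <Λ z) → NoAscent ((xs ++ [ y ]) ++ [ z ])
NoAscent-snoc []           _             y≮z = y≮z , tt
NoAscent-snoc (x ∷ [])     (x≮y , _)     y≮z = x≮y , y≮z , tt
NoAscent-snoc (x ∷ x' ∷ xs) (x≮x' , asc) y≮z = x≮x' , NoAscent-snoc (x' ∷ xs) asc y≮z

module _ {n : ℕ} where

  -- the last label of c(F) is that of a root of F
  labels-NoAscent-snoc : ∀ {F ℓ} → Covers n F → NoAscent (labels F) →
    (∀ {c l r} → node c l r ∈ F → ¬ (label (node c l r) <Λ ℓ)) → NoAscent (labels F ++ [ ℓ ])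
  labels-NoAscent-snoc {F} {ℓ} cv asc roots≮ℓ with split? F
  ... | inj₁ leafF rewrite revMinLinExt-leaves leafF = tt
  ... | inj₂ s rewrite labels-split cv s = NoAscent-snoc (labels (children s)) asc (roots≮ℓ (root-∈ s))

  children-roots-≮Λ : ∀ c {l r : Tree n} {R} → DistinctLeaves (l ∷ r ∷ R) → PointedLyndonTree (node c l r) →
    All PointedLyndonTree R → All (RootAtLeast (ν (node c l r))) R →
    ∀ {c' l' r'} → node c' l' r' ∈ l ∷ r ∷ R → ¬ (label (node c' l' r') <Λ label (node c l r))
  children-roots-≮Λ c {r = r} d (νt≡νl , (c≤c' , lyndon) , (νl≡νl' , _) , _) _ _ {c'} {l'} {r'} (here refl) =
    subst (λ a → ¬ (lab (ν l') (ν r') c' <Λ lab a (ν r) c)) (sym νl≡νl') (≮Λ-same-a c≤c' lyndon)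
  children-roots-≮Λ c {l} d (νt≡νl , _ , _ , (νr≡νr' , _)) _ _ (there (here refl)) =
    ≮Λ-by-a (subst (ν l Fin.<_) νr≡νr' (ν-left<ν-right c d νt≡νl))
  children-roots-≮Λ c {l} d (νt≡νl , _) plR ≥R (there (there s∈R)) =
    ≮Λ-by-a (subst (ν l Fin.<_) (proj₁ (All.lookup plR s∈R))
      (ν<ν-of-tail d (there s∈R) (subst (Fin._≤ _) νt≡νl (All.lookup ≥R s∈R))))

  AscentFreeRun : Forest n → Set
  AscentFreeRun F = ChainFrom (zeroP n) (chainTail (zeroP n) (revMinLinExt F)) (labels F) × NoAscent (labels F)

  ascentFreeRun : ∀ {F} → Covers n F → All PointedLyndonTree F → AscentFreeRun F
  ascentFreeRun = forest-induction (λ F → All PointedLyndonTree F → AscentFreeRun F)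
    (λ _ leafF _ → subst (λ vs → ChainFrom (zeroP n) (chainTail (zeroP n) vs) (map label vs) × NoAscent (map label vs))
                         (sym (revMinLinExt-leaves leafF)) (done , tt))
    onSplit
    where
    onSplit : ∀ {F} → Covers n F → (s : Split F) → (All PointedLyndonTree (children s) → AscentFreeRun (children s)) →
              All PointedLyndonTree F → AscentFreeRun F
    onSplit {F} cv s@(split c l r R _ ≥R) ih plF
      with PermP.All-resp-↭ (perm s) plF
    ... | plt@(νt≡νl , _ , pl , pr) ∷ plR
      with ih (pl ∷ pr ∷ plR)
    ... | chain , asc rewrite revMinLinExt-split cv s =
      ChainFrom-snoc (zeroP n) (revMinLinExt F') (root s) chain
        (subst (λ π → Step π (mergeStep π (root s)) (label (root s))) (sym (top-revMinLinExt cvF'))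
               (step-node c cvF' (ν-left<ν-right c dF' νt≡νl))) ,
      subst NoAscent (sym (LP.map-++ label (revMinLinExt F') [ root s ]))
            (labels-NoAscent-snoc cvF' asc (children-roots-≮Λ c dF' plt plR ≥R))
      where
      F'   = children s
      cvF' = Covers-children cv s
      dF'  = Covers⇒DistinctLeaves cvF'

  -- c is injective

  lookup-merge-second : ∀ (π : Part n) p {q} → lookup π q ≡ q → lookup (merge π p q) q ≡ p
  lookup-merge-second π p {q} q↦q = trans (lookup-merge π p q q) (mergeMap-joined (inj₂ q↦q))

  merge-injective : ∀ {π : Part n} {p q p' q'} → lookup π q ≡ q → lookup π q' ≡ q' → p ≢ q → p' ≢ q' →
                    merge π p q ≡ merge π p' q' → p ≡ p' × q ≡ q'
  merge-injective {π} {p} {q} {p'} {q'} q↦q q'↦q' p≢q p'≢q' eq = p≡p' , q≡q'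
    where
    at-q : p ≡ mergeMap p' q' q
    at-q = trans (sym (lookup-merge-second π p q↦q))
                 (trans (cong (λ σ → lookup σ q) eq) (trans (lookup-merge π p' q' q) (cong (mergeMap p' q') q↦q)))
    at-q' : p' ≡ mergeMap p q q'
    at-q' = trans (sym (lookup-merge-second π p' q'↦q'))
                  (trans (cong (λ σ → lookup σ q') (sym eq)) (trans (lookup-merge π p q q') (cong (mergeMap p q) q'↦q')))
    p≡p' : p ≡ p'
    p≡p' with mergeMap-cases p' q' q
    ... | inj₁ (e , _) = trans at-q e
    ... | inj₂ (e , _) = ⊥-elim (p≢q (trans at-q e))
    q≡q' : q ≡ q'
    q≡q' with mergeMap-cases p q q'
    ... | inj₁ (e , inj₁ q'≡p) = ⊥-elim (p'≢q' (trans (trans at-q' e) (sym q'≡p)))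
    ... | inj₁ (_ , inj₂ q'≡q) = sym q'≡q
    ... | inj₂ (e , _)         = ⊥-elim (p'≢q' (trans at-q' e))

  mergeBy-injective : ∀ {u u'} {π : Part n} {p q p' q'} → lookup π p ≡ p → lookup π q ≡ q → lookup π p' ≡ p' → lookup π q' ≡ q' →
    p ≢ q → p' ≢ q' → mergeBy u π p q ≡ mergeBy u' π p' q' → (u ≡ u' × p ≡ p' × q ≡ q') ⊎ (p ≡ q' × q ≡ p')
  mergeBy-injective {true}  {true}  p↦ q↦ p'↦ q'↦ p≢q p'≢q' eq =
    let p≡p' , q≡q' = merge-injective q↦ q'↦ p≢q p'≢q' eq in inj₁ (refl , p≡p' , q≡q')
  mergeBy-injective {false} {false} p↦ q↦ p'↦ q'↦ p≢q p'≢q' eq =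
    let q≡q' , p≡p' = merge-injective p↦ p'↦ (p≢q ∘ sym) (p'≢q' ∘ sym) eq in inj₁ (refl , p≡p' , q≡q')
  mergeBy-injective {true}  {false} p↦ q↦ p'↦ q'↦ p≢q p'≢q' eq =
    let p≡q' , q≡p' = merge-injective q↦ p'↦ p≢q (p'≢q' ∘ sym) eq in inj₂ (p≡q' , q≡p')
  mergeBy-injective {false} {true}  p↦ q↦ p'↦ q'↦ p≢q p'≢q' eq =
    let q≡p' , p≡q' = merge-injective p↦ q'↦ (p≢q ∘ sym) p'≢q' eq in inj₂ (p≡q' , q≡p')

  pointOf-≢ : ∀ {F} {s s' : Tree n} → DistinctLeaves F → s ∈ F → s' ∈ F → ν s Fin.< ν s' → pointOf s ≢ pointOf s'
  pointOf-≢ d s∈ s'∈ ν<ν e with pointOf-injective d s∈ s'∈ e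
  ... | refl = FinP.<-irrefl refl ν<ν

  mergeStep-injective : ∀ {F} → Covers n F → ∀ {c l r c' l' r'} → l ∈ F → r ∈ F → l' ∈ F → r' ∈ F →
    ν l Fin.< ν r → ν l' Fin.< ν r' →
    mergeStep (partOf F) (node c l r) ≡ mergeStep (partOf F) (node c' l' r') → node c l r ≡ node c' l' r'
  mergeStep-injective {F} cv {c} {l} {r} {c'} {l'} {r'} l∈ r∈ l'∈ r'∈ νl<νr νl'<νr' eq =
    nodes≡ (mergeBy-injective (partOf-pointOf d l∈) (partOf-pointOf d r∈) (partOf-pointOf d l'∈) (partOf-pointOf d r'∈)
             (pointOf-≢ d l∈ r∈ νl<νr) (pointOf-≢ d l'∈ r'∈ νl'<νr')
             (trans (sym (mergeStep-node π c l r (partOf-ν d l∈) (partOf-ν d r∈)))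
                    (trans eq (mergeStep-node π c' l' r' (partOf-ν d l'∈) (partOf-ν d r'∈)))))
    where
    π = partOf F
    d = Covers⇒DistinctLeaves cv
    nodes≡ : (c ≡ c' × pointOf l ≡ pointOf l' × pointOf r ≡ pointOf r') ⊎ (pointOf l ≡ pointOf r' × pointOf r ≡ pointOf l') →
             node c l r ≡ node c' l' r'
    nodes≡ (inj₁ (refl , pl≡pl' , pr≡pr'))
      with pointOf-injective d l∈ l'∈ pl≡pl' | pointOf-injective d r∈ r'∈ pr≡pr'
    ... | refl | refl = refl
    nodes≡ (inj₂ (pl≡pr' , pr≡pl'))
      with pointOf-injective d l∈ r'∈ pl≡pr' | pointOf-injective d r∈ l'∈ pr≡pl'
    ... | refl | refl = ⊥-elim (FinP.<-asym νl<νr νl'<νr')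

  leafForest : ∀ {F : Forest n} → All IsLeaf F → F ≡ map leaf (forestLeaves F)
  leafForest {[]}         []          = refl
  leafForest {leaf i ∷ F} (_ ∷ leafF) = cong (leaf i ∷_) (leafForest leafF)

  leafForests-↭ : ∀ {F G} → Covers n F → Covers n G → All IsLeaf F → All IsLeaf G → F ↭ G
  leafForests-↭ {F} {G} (covers F↭) (covers G↭) leafF leafG =
    subst₂ _↭_ (sym (leafForest leafF)) (sym (leafForest leafG)) (PermP.map⁺ leaf (↭-trans F↭ (↭-sym G↭)))

  c-split≢c-leaves : ∀ {F G} → Covers n F → (s : Split F) → All IsLeaf G → c n F ≢ c n G
  c-split≢c-leaves {F} cv s leafG eq = []≢snoc (chainTail (zeroP n) (revMinLinExt (children s))) (LP.∷-injectiveʳ (begin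
      zeroP n ∷ []                                                      ≡⟨ trans (sym (c-leaves leafG)) (sym eq) ⟩
      c n F                                                             ≡⟨ c-split cv s ⟩
      c n (children s) ++ [ partOf F ]                                  ≡⟨ cong (_++ [ partOf F ]) (runChain-∷ (zeroP n) _) ⟩
      zeroP n ∷ chainTail (zeroP n) (revMinLinExt (children s)) ++ [ partOf F ] ∎))
    where open ≡-Reasoning

  children-PLT : ∀ {F : Forest n} (s : Split F) → All PointedLyndonTree F → All PointedLyndonTree (children s)
  children-PLT s plF with PermP.All-resp-↭ (perm s) plF
  ... | (_ , _ , pl , pr) ∷ plR = pl ∷ pr ∷ plR

  root-normalized : ∀ {F : Forest n} (s : Split F) → All PointedLyndonTree F → ν (root s) ≡ ν (left s)
  root-normalized s plF = proj₁ (All.head (PermP.All-resp-↭ (perm s) plF))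

  split-ν< : ∀ {F} → Covers n F → (s : Split F) → All PointedLyndonTree F → ν (left s) Fin.< ν (right s)
  split-ν< cv s plF =
    ν-left<ν-right (colour s) {left s} {right s} (Covers⇒DistinctLeaves (Covers-children cv s)) (root-normalized s plF)

  ↭-via-roots : ∀ {F G : Forest n} {c l r R c' l' r' R'} → node c l r ≡ node c' l' r' →
                F ↭ node c l r ∷ R → G ↭ node c' l' r' ∷ R' → l ∷ r ∷ R ↭ l' ∷ r' ∷ R' → F ↭ G
  ↭-via-roots refl F↭ G↭ children↭ =
    ↭-trans F↭ (↭-trans (prep _ (PermP.drop-∷ (PermP.drop-∷ children↭))) (↭-sym G↭))

  c-injective-↭ : ∀ {F} → Covers n F → All PointedLyndonTree F →
                  ∀ {G} → Covers n G → All PointedLyndonTree G → c n F ≡ c n G → F ↭ G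
  c-injective-↭ = forest-induction
    (λ F → All PointedLyndonTree F → ∀ {G} → Covers n G → All PointedLyndonTree G → c n F ≡ c n G → F ↭ G)
    onLeaves onSplit
    where
    onLeaves : ∀ {F} → Covers n F → All IsLeaf F →
               All PointedLyndonTree F → ∀ {G} → Covers n G → All PointedLyndonTree G → c n F ≡ c n G → F ↭ G
    onLeaves {F} cv leafF _ {G} cvG _ eq with split? G
    ... | inj₁ leafG = leafForests-↭ cv cvG leafF leafG
    ... | inj₂ sG    = ⊥-elim (c-split≢c-leaves cvG sG leafF (sym eq))

    onSplit : ∀ {F} → Covers n F → (s : Split F) →
      (All PointedLyndonTree (children s) → ∀ {G} → Covers n G → All PointedLyndonTree G → c n (children s) ≡ c n G → children s ↭ G) →
      All PointedLyndonTree F → ∀ {G} → Covers n G → All PointedLyndonTree G → c n F ≡ c n G → F ↭ G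
    onSplit {F} cv s ih plF {G} cvG plG eq with split? G
    ... | inj₁ leafG = ⊥-elim (c-split≢c-leaves cv s leafG eq)
    ... | inj₂ sG = ↭-via-roots roots≡ (perm s) (perm sG) F'↭G'
      where
      open ≡-Reasoning
      F'   = children s
      G'   = children sG
      cvF' = Covers-children cv s
      cvG' = Covers-children cvG sG
      c≡c = LP.∷ʳ-injective (c n F') (c n G') (trans (sym (c-split cv s)) (trans eq (c-split cvG sG)))
      F'↭G' : F' ↭ G'
      F'↭G' = ih (children-PLT s plF) cvG' (children-PLT sG plG) (proj₁ c≡c)
      roots≡ : root s ≡ root sG
      roots≡ = mergeStep-injective cvF' (here refl) (there (here refl))
        (PermP.∈-resp-↭ (↭-sym F'↭G') (here refl)) (PermP.∈-resp-↭ (↭-sym F'↭G') (there (here refl)))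
        (split-ν< cv s plF) (split-ν< cvG sG plG)
        (begin
          mergeStep (partOf F') (root s)   ≡⟨ partOf-split cv s ⟨
          partOf F                         ≡⟨ proj₂ c≡c ⟩
          partOf G                         ≡⟨ partOf-split cvG sG ⟩
          mergeStep (partOf G') (root sG)  ≡⟨ cong (λ π → mergeStep π (root sG)) (partOf-resp-↭ cvF' F'↭G') ⟨
          mergeStep (partOf F') (root sG)  ∎)

  -- c is surjective

  blockTree : ∀ {S : Forest n} {p a} → Covers n S → IsBlockMin (partOf S) p a →
              Σ (Tree n) λ t → t ∈ S × ν t ≡ a × pointOf t ≡ p
  blockTree {S} {p} {a} cv (a↦p , a≤block) with Covers⇒tree cv a
  ... | t , t∈S , a∈t = t , t∈S , FinP.≤-antisym (ν≤leaves t a∈t) (a≤block (ν t) νt↦p) , pointOf≡p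
    where
    d = Covers⇒DistinctLeaves cv
    pointOf≡p : pointOf t ≡ p
    pointOf≡p = trans (sym (lookup-partOf d t∈S a∈t)) a↦p
    νt↦p : lookup (partOf S) (ν t) ≡ p
    νt↦p = trans (partOf-ν d t∈S) pointOf≡p

  -- the internal roots of S may be merged next by a step labelled ℓ without creating an ascent
  Extendable : Forest n → Label n → Set
  Extendable S ℓ = ∀ {c l r} → node c l r ∈ S →
    Label.a ℓ Fin.≤ ν (node c l r) × (ν (node c l r) ≡ Label.a ℓ → ¬ (label (node c l r) <Λ ℓ))

  leftCond : ∀ u {tA tB : Tree n} {R} → DistinctLeaves (tA ∷ tB ∷ R) → PointedLyndonTree tA →
             (¬ IsLeaf tA → ¬ (label tA <Λ lab (ν tA) (ν tB) u)) → LeftCond u tA tB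
  leftCond u {leaf _} d _ _ = tt
  leftCond u {tA@(node c ll lr)} {tB} d (νtA≡νll , _) ≮ℓ = colour≤ u c (≮ℓ λ ()) , lyndon u c (≮ℓ λ ())
    where
    ≮ℓ' : ∀ {c' ℓ} → ¬ (lab (ν ll) (ν lr) c' <Λ ℓ) → ¬ (lab (ν tA) (ν lr) c' <Λ ℓ)
    ≮ℓ' {c'} {ℓ} = subst (λ a → ¬ (lab a (ν lr) c' <Λ ℓ)) (sym νtA≡νll)
    colour≤ : ∀ u c → ¬ (lab (ν ll) (ν lr) c <Λ lab (ν tA) (ν tB) u) → u ≤𝔹 c
    colour≤ false false _ = b≤b
    colour≤ false true  _ = f≤t
    colour≤ true  true  _ = b≤b
    colour≤ true  false ≮ = ⊥-elim (≮ℓ' ≮ A<C)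
    lyndon : ∀ u c → ¬ (lab (ν ll) (ν lr) c <Λ lab (ν tA) (ν tB) u) → c ≡ true → u ≡ true → ν tB Fin.< ν lr
    lyndon true true ≮ refl refl with FinP.<-cmp (ν tB) (ν lr)
    ... | tri< νB<νlr _ _ = νB<νlr
    ... | tri≈ _ νB≡νlr _ = ⊥-elim (headDisjoint d (here refl) (∈-++⁺ʳ (leaves ll) (ν∈leaves lr))
                                      (subst (_∈ leaves tB) νB≡νlr (ν∈leaves tB)))
    ... | tri> _ _ νlr<νB = ⊥-elim (≮ℓ' ≮ (inC νlr<νB))

  node-PLT : ∀ u {tA tB : Tree n} {R} → DistinctLeaves (tA ∷ tB ∷ R) → ν tA Fin.< ν tB →
             PointedLyndonTree tA → PointedLyndonTree tB →
             (¬ IsLeaf tA → ¬ (label tA <Λ lab (ν tA) (ν tB) u)) → PointedLyndonTree (node u tA tB)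
  node-PLT u d νA<νB pA pB ≮ℓ = minF≡ˡ (ℕP.<⇒≤ νA<νB) , leftCond u d pA ≮ℓ , pA , pB

  node-extendable : ∀ {u} {tA tB : Tree n} {R ℓ'} → ν tA Fin.< ν tB →
    (∀ {c l r} → node c l r ∈ R → ν tA Fin.< ν (node c l r)) →
    ¬ (lab (ν tA) (ν tB) u <Λ ℓ') → Extendable (node u tA tB ∷ R) ℓ'
  node-extendable {ℓ' = lab a' _ _} νA<νB νA<R ≮ℓ' (here refl) =
    subst (a' Fin.≤_) (sym (minF≡ˡ (ℕP.<⇒≤ νA<νB))) a'≤νA , λ _ → ≮ℓ'
    where a'≤νA = ℕP.≮⇒≥ (λ νA<a' → ≮ℓ' (diff-a νA<a'))
  node-extendable {ℓ' = lab a' _ _} νA<νB νA<R ≮ℓ' (there s∈R) =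
    ℕP.<⇒≤ a'<νs , λ νs≡a' → ⊥-elim (ℕP.<-irrefl (cong toℕ (sym νs≡a')) a'<νs)
    where a'<νs = ℕP.≤-<-trans (ℕP.≮⇒≥ (λ νA<a' → ≮ℓ' (diff-a νA<a'))) (νA<R s∈R)

  record Extension (S : Forest n) (π' : Part n) (ℓ : Label n) : Set where
    constructor extension
    field
      forest        : Forest n
      covering      : Covers n forest
      pointedLyndon : All PointedLyndonTree forest
      partOf≡       : partOf forest ≡ π'
      c≡            : c n forest ≡ c n S ++ [ π' ]
      extendable    : ∀ {ℓ'} → ¬ (ℓ <Λ ℓ') → Extendable forest ℓ'

  -- the step joins the trees tA, tB whose valencies are the two block minima into node u tA tB
  extend : ∀ {S π' ℓ} → Covers n S → All PointedLyndonTree S → Extendable S ℓ → Step (partOf S) π' ℓ →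
           Extension S π' ℓ
  extend {S} {π'} {lab _ _ u} cv plS ext (_ , a<b , _ , _ , _ , _ , blockA , blockB , π'≡)
    with blockTree cv blockA | blockTree cv blockB
  ... | tA , tA∈S , refl , refl | tB , tB∈S , refl , refl
    with ∈₂⇒↭∷∷ tA∈S tB∈S (λ tA≡tB → FinP.<-irrefl (cong ν tA≡tB) a<b)
  ... | R , S↭ = extension (t ∷ R) cv' (pT ∷ plR) partOf≡π' c≡ (node-extendable a<b rootR-ν>)
    where
    open ≡-Reasoning
    t    = node u tA tB
    cvC  = Covers-resp-↭ S↭ cv
    dC   = Covers⇒DistinctLeaves cvC
    cv'  = Covers-node u cvC
    plC  = PermP.All-resp-↭ S↭ plS
    plR  = All.tail (All.tail plC)
    νt≡νA : ν t ≡ ν tA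
    νt≡νA = minF≡ˡ (ℕP.<⇒≤ a<b)
    ∈S : ∀ {s} → s ∈ R → s ∈ S
    ∈S s∈R = PermP.∈-resp-↭ (↭-sym S↭) (there (there s∈R))
    rootR-ν> : ∀ {c l r} → node c l r ∈ R → ν tA Fin.< ν (node c l r)
    rootR-ν> s∈R = ν<ν-of-tail dC (there s∈R) (proj₁ (ext (∈S s∈R)))
    pT : PointedLyndonTree t
    pT = node-PLT u dC a<b (All.head plC) (All.head (All.tail plC)) (root-≮ tA∈S refl)
      where
      root-≮ : ∀ {s} → s ∈ S → ν s ≡ ν tA → ¬ IsLeaf s → ¬ (label s <Λ lab (ν tA) (ν tB) u)
      root-≮ {leaf _}     _   _   internal = ⊥-elim (internal tt)
      root-≮ {node _ _ _} s∈S νs≡ _        = proj₂ (ext s∈S) νs≡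
    minimal : All (RootAtLeast (ν t)) R
    minimal = All.tabulate rootAtLeast
      where
      rootAtLeast : ∀ {s} → s ∈ R → RootAtLeast (ν t) s
      rootAtLeast {leaf _}     _   = tt
      rootAtLeast {node _ _ _} s∈R = subst (Fin._≤ _) (sym νt≡νA) (ℕP.<⇒≤ (rootR-ν> s∈R))
    sp : Split (t ∷ R)
    sp = split u tA tB R refl minimal
    partOf≡π' : partOf (t ∷ R) ≡ π'
    partOf≡π' = begin
      partOf (t ∷ R)                   ≡⟨ partOf-split cv' sp ⟩
      mergeStep (partOf (tA ∷ tB ∷ R)) t ≡⟨ cong (λ π → mergeStep π t) (partOf-resp-↭ cv S↭) ⟨
      mergeStep (partOf S) t           ≡⟨ mergeStep-node (partOf S) u tA tB (partOf-ν d tA∈S) (partOf-ν d tB∈S) ⟩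
      mergeBy u (partOf S) (pointOf tA) (pointOf tB) ≡⟨ π'≡ ⟨
      π'                               ∎
      where d = Covers⇒DistinctLeaves cv
    c≡ : c n (t ∷ R) ≡ c n S ++ [ π' ]
    c≡ = begin
      c n (t ∷ R)                           ≡⟨ c-split cv' sp ⟩
      c n (tA ∷ tB ∷ R) ++ [ partOf (t ∷ R) ] ≡⟨ cong₂ (λ cs π → cs ++ [ π ]) (c-resp-↭ cv S↭) (sym partOf≡π') ⟨
      c n S ++ [ π' ]                       ∎
  ExtendableBy : Forest n → List (Label n) → Set
  ExtendableBy S []      = ⊤
  ExtendableBy S (ℓ ∷ _) = Extendable S ℓ

  ExtendableBy-next : ∀ {S ℓ} ls → (∀ {ℓ'} → ¬ (ℓ <Λ ℓ') → Extendable S ℓ') → NoAscent (ℓ ∷ ls) →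
                      ExtendableBy S ls × NoAscent ls
  ExtendableBy-next []      _   _            = tt , tt
  ExtendableBy-next (_ ∷ _) ext (≮ℓ' , asc)  = ext ≮ℓ' , asc

  realize : ∀ {S rest ls} → Covers n S → All PointedLyndonTree S → ExtendableBy S ls →
            ChainFrom (partOf S) rest ls → NoAscent ls →
            Σ (Forest n) λ F → Covers n F × All PointedLyndonTree F × c n F ≡ c n S ++ rest
  realize {S} cv plS _ done _ = S , cv , plS , sym (LP.++-identityʳ (c n S))
  realize {S} {π' ∷ rest} {ℓ ∷ ls} cv plS ext (step stepℓ chain) asc
    with extend cv plS ext stepℓ
  ... | extension S' cv' plS' partOf≡ c≡ ext'
    with ExtendableBy-next ls ext' asc
  ... | extS' , ascS'
    with realize cv' plS' extS' (subst (λ π → ChainFrom π rest ls) (sym partOf≡) chain) ascS'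
  ... | F , cvF , plF , cF≡ = F , cvF , plF , (begin
      c n F                        ≡⟨ cF≡ ⟩
      c n S' ++ rest               ≡⟨ cong (_++ rest) c≡ ⟩
      (c n S ++ [ π' ]) ++ rest    ≡⟨ LP.++-assoc (c n S) [ π' ] rest ⟩
      c n S ++ π' ∷ rest           ∎)
    where open ≡-Reasoning

  singletons : Forest n
  singletons = map leaf (allFin n)

  singletons-leaves : All IsLeaf singletons
  singletons-leaves = AllP.map⁺ (All.universal (λ _ → tt) (allFin n))

  singletons-covers : Covers n singletons
  singletons-covers = covers (subst (_↭ allFin n) (sym leaves≡) refl)
    where
    leaves≡ : forestLeaves singletons ≡ allFin n
    leaves≡ = trans (LP.concatMap-map leaves leaf (allFin n)) (LP.concatMap-pure (allFin n))

  leaf⇒PLT : ∀ {t : Tree n} → IsLeaf t → PointedLyndonTree t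
  leaf⇒PLT {leaf _} _ = tt

  singletons-extendable : ∀ ls → ExtendableBy singletons ls
  singletons-extendable []      = tt
  singletons-extendable (_ ∷ _) t∈ = ⊥-elim (All.lookup singletons-leaves t∈)

  valencies-distinct : ∀ {F : Forest n} → DistinctLeaves F → AllPairs (λ s t → ν s ≢ ν t) F
  valencies-distinct {[]}    _ = AllPairs.[]
  valencies-distinct {s ∷ F} d =
    All.tabulate (λ {t} t∈F νs≡νt → headDisjoint d t∈F (ν∈leaves s) (subst (_∈ leaves t) (sym νs≡νt) (ν∈leaves t)))
    ∷ valencies-distinct (DistinctLeaves-tail d)

  open Sort (On.decTotalOrder (FinP.≤-decTotalOrder n) ν) using (sort; sort-↭; sort-↗)

  sort-strictlyIncreasing : ∀ {F : Forest n} → DistinctLeaves F → Linked (λ s t → toℕ (ν s) ℕ.< toℕ (ν t)) (sort F)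
  sort-strictlyIncreasing {F} d = Linked.zipWith (λ (ν≤ν , ν≢ν) → FinP.≤∧≢⇒< ν≤ν ν≢ν)
    (sort-↗ F , AllPairs⇒Linked (valencies-distinct (DistinctLeaves-resp-↭ (↭-sym (sort-↭ F)) d)))

  c-ascentFree : ∀ {F} → PointedLyndonForest n F → AscentFreeChain n (c n F)
  c-ascentFree {F} (plF , F↭ , _) =
    chainTail (zeroP n) (revMinLinExt F) , labels F , runChain-∷ (zeroP n) (revMinLinExt F) , ascentFreeRun (covers F↭) plF

  c-injective : ∀ {F G} → PointedLyndonForest n F → PointedLyndonForest n G → c n F ≡ c n G → F ≡ G
  c-injective (plF , F↭ , <F) (plG , G↭ , <G) cF≡cG =
    ↭-AllPairs-unique ℕP.<-asym (Linked⇒AllPairs ℕP.<-trans <F) (Linked⇒AllPairs ℕP.<-trans <G)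
      (c-injective-↭ (covers F↭) plF (covers G↭) plG cF≡cG)

  c-surjective : ∀ {ch} → AscentFreeChain n ch → Σ (Forest n) λ F → PointedLyndonForest n F × c n F ≡ ch
  c-surjective {ch} (rest , ls , ch≡ , chain , asc)
    with realize singletons-covers (All.map leaf⇒PLT singletons-leaves) (singletons-extendable ls)
           (subst (λ π → ChainFrom π rest ls) (sym (partOf-leaves singletons-covers singletons-leaves)) chain) asc
  ... | F , cvF , plF , cF≡ = sort F ,
      (PermP.All-resp-↭ (↭-sym (sort-↭ F)) plF , leaves↭allFin (Covers-resp-↭ (↭-sym (sort-↭ F)) cvF) ,
       sort-strictlyIncreasing (Covers⇒DistinctLeaves cvF)) ,
      (begin
        c n (sort F)               ≡⟨ c-resp-↭ cvF (↭-sym (sort-↭ F)) ⟨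
        c n F                      ≡⟨ cF≡ ⟩
        c n singletons ++ rest     ≡⟨ cong (_++ rest) (c-leaves singletons-leaves) ⟩
        zeroP n ∷ rest             ≡⟨ ch≡ ⟨
        ch                         ∎)
    where open ≡-Reasoning

theorem3p6 : (n : ℕ) → 1 ≤ n →
    ((F : Forest n) → PointedLyndonForest n F → AscentFreeChain n (c n F))
    × ((F G : Forest n) → PointedLyndonForest n F → PointedLyndonForest n G →
         c n F ≡ c n G → F ≡ G)
    × ((ch : List (Part n)) → AscentFreeChain n ch →
         Σ (Forest n) λ F → PointedLyndonForest n F × (c n F ≡ ch))
theorem3p6 n _ = (λ _ → c-ascentFree) , (λ _ _ → c-injective) , (λ _ → c-surjective)
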